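{- Let $G$ be a finite simple connected graph, let $\ell \ge 1$, and let $H$ be a retract of $G$. Then $c_\ell(H) \le c_\ell(G)$ and $c'_\ell(H) \le c'_\ell(G)$.
   Context: $\ell$-visibility Cops and Robber on a graph $G$: in round 0 a set of cops each choose a vertex, then a single robber chooses a vertex. In each subsequent round, every cop moves to a neighbouring vertex or stays put, and then the robber moves to a neighbouring vertex or stays put. The robber always knows the positions of all cops. The cops know the robber's position only at moments when some cop and the robber occupy vertices $x,y$ with $d(x,y)\le \ell$ (the cops then "see" the robber and share this information). The cops capture the robber if a cop occupies the robber's vertex. $c_\ell(G)$ is the minimum number of cops that can guarantee capture, and $c'_\ell(G)$ is the minimum number of cops that can guarantee that at some moment some cop is within distance $\ell$ of the robber. A subgraph $H$ of $G$ is a retract if there is a graph homomorphism $f:V(G)\to V(H)$ (of reflexive graphs, i.e. adjacent vertices map to adjacent or equal vertices) with $f(v)=v$ for all $v\in V(H)$. -}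

module Defs where

open import Data.Nat using (ℕ; zero; suc; _≤_)
open import Data.Fin using (Fin)
open import Data.Fin.Properties using (any?) renaming (_≟_ to _≟ᶠ_)
open import Data.Product using (Σ; ∃; _×_; _,_; proj₁; proj₂)
open import Data.Sum using (_⊎_; inj₁; inj₂)
open import Data.List using (List; []; _∷_)
open import Data.Maybe using (Maybe; just; nothing)
open import Relation.Nullary using (¬_; Dec; yes; no)
open import Relation.Nullary.Decidable using (_⊎-dec_; _×-dec_)
open import Relation.Binary using (Decidable)
open import Relation.Binary.PropositionalEquality using (_≡_)
open import Function.Definitions using (Injective)

record Graph (n : ℕ) : Set₁ where
  field
    Adj    : Fin n → Fin n → Set
    adj?   : Decidable Adj
    sym    : ∀ {x y} → Adj x y → Adj y x
    irrefl : ∀ {x} → ¬ Adj x x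
open Graph public

-- x and y are adjacent or equal (a legal move / reflexive-graph edge)
AdjOrEq : ∀ {n} → Graph n → Fin n → Fin n → Set
AdjOrEq G x y = Adj G x y ⊎ x ≡ y

-- Within G l x y : d_G(x,y) ≤ l, i.e. there is a walk of length ≤ l
Within : ∀ {n} → Graph n → ℕ → Fin n → Fin n → Set
Within G zero    x y = x ≡ y
Within G (suc l) x y = Within G l x y ⊎ ∃ λ z → Adj G x z × Within G l z y

within? : ∀ {n} (G : Graph n) (l : ℕ) → Decidable (Within G l)
within? G zero    x y = x ≟ᶠ y
within? G (suc l) x y =
  within? G l x y ⊎-dec any? (λ z → adj? G x z ×-dec within? G l z y)

-- connected (and nonempty)
Connected : ∀ {n} → Graph n → Set
Connected {n} G = Fin n × (∀ x y → Σ ℕ λ l → Within G l x y)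

-- Retracts.  H (on Fin m) is a subgraph of G via an injective vertex
-- map ι, and f : V(G) → V(H) is a homomorphism of reflexive graphs
-- with f (ι a) = a for every vertex a of H.

record Retract {n m : ℕ} (G : Graph n) (H : Graph m) : Set where
  field
    ι       : Fin m → Fin n
    ι-inj   : Injective _≡_ _≡_ ι
    ι-sub   : ∀ {a b} → Adj H a b → Adj G (ι a) (ι b)
    f       : Fin n → Fin m
    f-hom   : ∀ {x y} → Adj G x y → AdjOrEq H (f x) (f y)
    f-fix   : ∀ a → f (ι a) ≡ a

Config : ℕ → ℕ → Set
Config n k = Fin k → Fin n

-- What the cops observe at a moment: the robber's vertex if some cop is
-- within distance ℓ of it, nothing otherwise.
Obs : ℕ → Set
Obs n = Maybe (Fin n)

observe : ∀ {n k} (G : Graph n) (ℓ : ℕ) → Config n k → Fin n → Obs n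
observe G ℓ c x with any? (λ i → within? G ℓ (c i) x)
... | yes _ = just x
... | no  _ = nothing

-- A (deterministic) cop strategy: initial placement, and a move rule that
-- depends on the history of observations (most recent first) and the
-- cops' current positions; every cop moves to a neighbour or stays.
record Strategy {n : ℕ} (G : Graph n) (k : ℕ) : Set where
  field
    start : Config n k
    next  : List (Obs n) → Config n k → Config n k
    legal : ∀ h c i → AdjOrEq G (c i) (next h c i)
open Strategy public

record RobberWalk {n : ℕ} (G : Graph n) : Set where
  field
    pos  : ℕ → Fin n
    step : ∀ t → AdjOrEq G (pos t) (pos (suc t))
open RobberWalk public

-- state after round t: cop configuration and observation history.
-- Round 0: cops placed, robber placed, one observation.
-- Round t+1: cops move (observation), robber moves (observation).
state : ∀ {n k} (G : Graph n) (ℓ : ℕ) → Strategy G k → RobberWalk G →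
        ℕ → Config n k × List (Obs n)
state G ℓ σ r zero = start σ , (observe G ℓ (start σ) (pos r zero) ∷ [])
state G ℓ σ r (suc t) with state G ℓ σ r t
... | c , h =
  let c' = next σ h c
      o₁ = observe G ℓ c' (pos r t)
      o₂ = observe G ℓ c' (pos r (suc t))
  in c' , (o₂ ∷ o₁ ∷ h)

copsAt : ∀ {n k} (G : Graph n) (ℓ : ℕ) → Strategy G k → RobberWalk G →
         ℕ → Config n k
copsAt G ℓ σ r t = proj₁ (state G ℓ σ r t)

HoldsInRound : ∀ {n k} (G : Graph n) (ℓ : ℕ) → Strategy G k → RobberWalk G →
               (Config n k → Fin n → Set) → ℕ → Set
HoldsInRound G ℓ σ r P zero    = P (copsAt G ℓ σ r zero) (pos r zero)
HoldsInRound G ℓ σ r P (suc t) =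
  P (copsAt G ℓ σ r (suc t)) (pos r t) ⊎ P (copsAt G ℓ σ r (suc t)) (pos r (suc t))

Caught : ∀ {n k} → Config n k → Fin n → Set
Caught c x = ∃ λ i → c i ≡ x

Seen : ∀ {n k} → Graph n → ℕ → Config n k → Fin n → Set
Seen G ℓ c x = ∃ λ i → Within G ℓ (c i) x

CopsWin : ∀ {n} → Graph n → ℕ → ℕ → Set
CopsWin G ℓ k = Σ (Strategy G k) λ σ → (r : RobberWalk G) →
  ∃ λ t → HoldsInRound G ℓ σ r Caught t

CopsSee : ∀ {n} → Graph n → ℕ → ℕ → Set
CopsSee G ℓ k = Σ (Strategy G k) λ σ → (r : RobberWalk G) →
  ∃ λ t → HoldsInRound G ℓ σ r (Seen G ℓ) t

IsCopNumber : ∀ {n} → Graph n → ℕ → ℕ → Set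
IsCopNumber G ℓ c = CopsWin G ℓ c × (∀ k → CopsWin G ℓ k → c ≤ k)

IsSeeNumber : ∀ {n} → Graph n → ℕ → ℕ → Set
IsSeeNumber G ℓ c = CopsSee G ℓ c × (∀ k → CopsSee G ℓ k → c ≤ k)

module Submission where

-- Let f : G → H be the retraction and ι : H → G the inclusion.  Given a
-- cop strategy σ on G, the cops on H play the "shadow" of σ: they
-- privately run σ against the lifted robber ι ∘ r and stand at the
-- f-images of σ's cops.  Three facts make this work.
--   * A reflexive homomorphism does not increase distances, so whenever
--     a σ-cop sees (resp. catches) ι x, its shadow sees (catches) x.
--   * Hence the H-cops' observations determine what σ observes: seeing
--     a robber at a in H, they recompute whether σ sees ι a, and if
--     they do not see it, neither does σ.  So the whole history of σ
--     can be decoded from the history of the shadow play.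
--   * Shadow moves are legal, because f maps legal moves to legal moves.
-- By induction on rounds the shadow cops are always at the f-images of
-- σ's cops, so any round in which σ wins against ι ∘ r is a round in
-- which the shadow strategy wins against r.

open import Defs
open import Data.Nat using (ℕ; zero; suc; _≤_)
open import Data.Fin using (Fin)
open import Data.Fin.Properties using (any?) renaming (_≟_ to _≟ᶠ_)
open import Data.Product using (_×_; _,_; proj₁; proj₂)
open import Data.Sum using (_⊎_; inj₁; inj₂)
open import Data.List using (List; []; _∷_)
open import Data.Maybe using (just; nothing)
open import Data.Empty using (⊥-elim)
open import Function using (_∘_)
open import Relation.Nullary using (Dec; yes; no)
open import Relation.Nullary.Decidable using (_⊎-dec_)
open import Relation.Binary.PropositionalEquality
  using (_≡_; refl; trans; cong; cong₂; subst; subst₂)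
  renaming (sym to ≡-sym)

IsHom : ∀ {n m} → Graph n → Graph m → (Fin n → Fin m) → Set
IsHom G H f = ∀ {x y} → Adj G x y → AdjOrEq H (f x) (f y)

hom-AdjOrEq : ∀ {n m} {G : Graph n} {H : Graph m} {f : Fin n → Fin m} →
  IsHom G H f → ∀ {x y} → AdjOrEq G x y → AdjOrEq H (f x) (f y)
hom-AdjOrEq hom (inj₁ a) = hom a
hom-AdjOrEq hom (inj₂ e) = inj₂ (cong _ e)

hom-Within : ∀ {n m} {G : Graph n} {H : Graph m} {f : Fin n → Fin m} →
  IsHom G H f → ∀ l {x y} → Within G l x y → Within H l (f x) (f y)
hom-Within hom zero    e                  = cong _ e
hom-Within hom (suc l) (inj₁ w)           = inj₁ (hom-Within hom l w)
hom-Within {H = H} {f} hom (suc l) {y = y} (inj₂ (z , a , w)) with hom a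
... | inj₁ a' = inj₂ (f z , a' , hom-Within hom l w)
... | inj₂ e  = inj₁ (subst (λ u → Within H l u (f y)) (≡-sym e) (hom-Within hom l w))

Shadows : ∀ {n m k} → (Fin n → Fin m) → Config m k → Config n k → Set
Shadows f cH cG = ∀ i → cH i ≡ f (cG i)

module _ {n m} {G : Graph n} {H : Graph m} (R : Retract G H) where
  open Retract R

  caught-shadow : ∀ {k} {cH : Config m k} {cG : Config n k} → Shadows f cH cG →
    ∀ x → Caught cG (ι x) → Caught cH x
  caught-shadow sh x (i , e) = i , trans (sh i) (trans (cong f e) (f-fix x))

  seen-shadow : ∀ ℓ {k} {cH : Config m k} {cG : Config n k} → Shadows f cH cG →
    ∀ x → Seen G ℓ cG (ι x) → Seen H ℓ cH x
  seen-shadow ℓ sh x (i , w) =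
    i , subst₂ (Within H ℓ) (≡-sym (sh i)) (f-fix x) (hom-Within f-hom ℓ w)

  liftWalk : RobberWalk H → RobberWalk G
  liftWalk r = record { pos = ι ∘ pos r ; step = liftStep }
    where
    liftStep : ∀ t → AdjOrEq G (ι (pos r t)) (ι (pos r (suc t)))
    liftStep t with step r t
    ... | inj₁ a = inj₁ (ι-sub a)
    ... | inj₂ e = inj₂ (cong ι e)

-- Move each cop to its target if that is a legal move, else stay.
-- This makes any target assignment into a legal move rule.
module Clamp {m} (H : Graph m) where
  adjOrEq? : ∀ x y → Dec (AdjOrEq H x y)
  adjOrEq? x y = adj? H x y ⊎-dec (x ≟ᶠ y)

  clamp : ∀ {k} → Config m k → Config m k → Config m k
  clamp c t i with adjOrEq? (c i) (t i)
  ... | yes _ = t i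
  ... | no  _ = c i

  clamp-legal : ∀ {k} (c t : Config m k) i → AdjOrEq H (c i) (clamp c t i)
  clamp-legal c t i with adjOrEq? (c i) (t i)
  ... | yes p = p
  ... | no  _ = inj₂ refl

  clamp-reaches : ∀ {k} (c t : Config m k) i → AdjOrEq H (c i) (t i) → clamp c t i ≡ t i
  clamp-reaches c t i p with adjOrEq? (c i) (t i)
  ... | yes _  = refl
  ... | no  ¬p = ⊥-elim (¬p p)

module Shadow {n m} {G : Graph n} {H : Graph m} (R : Retract G H)
              (ℓ k : ℕ) (σ : Strategy G k) where
  open Retract R
  open Clamp H

  decodeObs : Config n k → Obs m → Obs n
  decodeObs c nothing  = nothing
  decodeObs c (just a) = observe G ℓ c (ι a)

  decodeObs-correct : ∀ {cH : Config m k} {cG : Config n k} → Shadows f cH cG →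
    ∀ a → decodeObs cG (observe H ℓ cH a) ≡ observe G ℓ cG (ι a)
  decodeObs-correct {cH} {cG} sh a with any? (λ i → within? H ℓ (cH i) a)
  ... | yes _  = refl
  ... | no ¬sH with any? (λ i → within? G ℓ (cG i) (ι a))
  ...   | no  _  = refl
  ...   | yes sG = ⊥-elim (¬sH (seen-shadow R ℓ sh a sG))

  GState : Set
  GState = Config n k × List (Obs n)

  replayRound : GState → Obs m → Obs m → GState
  replayRound (c , h) o₂ o₁ = let c' = next σ h c in c' , (decodeObs c' o₂ ∷ decodeObs c' o₁ ∷ h)

  replay : List (Obs m) → GState
  replay []            = start σ , []
  replay (o ∷ [])      = start σ , (decodeObs (start σ) o ∷ [])
  replay (o₂ ∷ o₁ ∷ h) = replayRound (replay h) o₂ o₁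

  target : List (Obs m) → Config m k
  target h i = let (c , h') = replay h in f (next σ h' c i)

  shadowStrategy : Strategy H k
  shadowStrategy = record
    { start = f ∘ start σ
    ; next  = λ h c → clamp c (target h)
    ; legal = λ h c → clamp-legal c (target h) }

  module Play (r : RobberWalk H) where
    stateG : ℕ → GState
    stateG = state G ℓ σ (liftWalk R r)

    stateH : ℕ → Config m k × List (Obs m)
    stateH = state H ℓ shadowStrategy r

    next-shadows : ∀ hH (cH : Config m k) (s : GState) → replay hH ≡ s →
      Shadows f cH (proj₁ s) →
      Shadows f (clamp cH (target hH)) (next σ (proj₂ s) (proj₁ s))
    next-shadows hH cH s refl sh i =
      clamp-reaches cH (target hH) i
        (subst (λ u → AdjOrEq H u (target hH i)) (≡-sym (sh i))
          (hom-AdjOrEq {G = G} {H} {f} f-hom (legal σ (proj₂ s) (proj₁ s) i)))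

    Invariant : ℕ → Set
    Invariant t = Shadows f (proj₁ (stateH t)) (proj₁ (stateG t))
                × replay (proj₂ (stateH t)) ≡ stateG t

    invariant : ∀ t → Invariant t
    invariant zero =
      (λ _ → refl) , cong (λ o → start σ , (o ∷ [])) (decodeObs-correct (λ _ → refl) (pos r zero))
    invariant (suc t) = sh' , replay-correct
      where
      prev = invariant t
      cH' = proj₁ (stateH (suc t))
      cG' = proj₁ (stateG (suc t))
      sh' : Shadows f cH' cG'
      sh' = next-shadows (proj₂ (stateH t)) (proj₁ (stateH t)) (stateG t) (proj₂ prev) (proj₁ prev)
      replay-correct : replay (proj₂ (stateH (suc t))) ≡ stateG (suc t)
      replay-correct = trans
        (cong (λ s → replayRound s (observe H ℓ cH' (pos r (suc t))) (observe H ℓ cH' (pos r t)))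
              (proj₂ prev))
        (cong₂ (λ o₂ o₁ → cG' , (o₂ ∷ o₁ ∷ proj₂ (stateG t)))
               (decodeObs-correct sh' (pos r (suc t))) (decodeObs-correct sh' (pos r t)))

    holds-shadow : (PG : Config n k → Fin n → Set) (PH : Config m k → Fin m → Set) →
      (∀ {cH cG} → Shadows f cH cG → ∀ x → PG cG (ι x) → PH cH x) →
      ∀ t → HoldsInRound G ℓ σ (liftWalk R r) PG t → HoldsInRound H ℓ shadowStrategy r PH t
    holds-shadow PG PH transfer zero    p        = transfer (proj₁ (invariant zero)) _ p
    holds-shadow PG PH transfer (suc t) (inj₁ p) = inj₁ (transfer (proj₁ (invariant (suc t))) _ p)
    holds-shadow PG PH transfer (suc t) (inj₂ p) = inj₂ (transfer (proj₁ (invariant (suc t))) _ p)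

copsWin-retract : ∀ {n m} {G : Graph n} {H : Graph m} → Retract G H →
  ∀ ℓ k → CopsWin G ℓ k → CopsWin H ℓ k
copsWin-retract R ℓ k (σ , wins) = shadowStrategy , λ r →
    let (t , p) = wins (liftWalk R r) in t , Play.holds-shadow r Caught Caught (caught-shadow R) t p
  where open Shadow R ℓ k σ

copsSee-retract : ∀ {n m} {G : Graph n} {H : Graph m} → Retract G H →
  ∀ ℓ k → CopsSee G ℓ k → CopsSee H ℓ k
copsSee-retract {G = G} {H} R ℓ k (σ , sees) = shadowStrategy , λ r →
    let (t , p) = sees (liftWalk R r) in t , Play.holds-shadow r (Seen G ℓ) (Seen H ℓ) (seen-shadow R ℓ) t p
  where open Shadow R ℓ k σ

theorem2p1 : ∀ {n m} (G : Graph n) (H : Graph m) (ℓ : ℕ) → 1 ≤ ℓ →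
    Connected G → Retract G H →
    (∀ cG cH → IsCopNumber G ℓ cG → IsCopNumber H ℓ cH → cH ≤ cG) ×
    (∀ cG cH → IsSeeNumber G ℓ cG → IsSeeNumber H ℓ cH → cH ≤ cG)
theorem2p1 G H ℓ _ _ R =
  (λ cG cH (winG , _) (_ , minimalH) → minimalH cG (copsWin-retract R ℓ cG winG)) ,
  (λ cG cH (seeG , _) (_ , minimalH) → minimalH cG (copsSee-retract R ℓ cG seeG))
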